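{- Let $n,m\ge 1$ be integers such that $K_{n,m}$ is not $K_{1,1}$ and not $K_{2,2}$. Then $\chi'_{qm\Sigma}(K_{n,m})=2$ if $n\ne m$, and $\chi'_{qm\Sigma}(K_{n,m})=3$ if $n=m$.
   Context: A $k$-edge-coloring of a graph $G$ is any map $c:E(G)\to[k]$ (adjacent edges may receive the same color). It induces $\sigma_c(v)=\sum_{u\in N(v)}c(vu)$. The coloring is neighbor sum distinguishing (NSD) if $\sigma_c(u)\ne\sigma_c(v)$ for every edge $uv$, and quasi-majority (QM) if every vertex $v$ is incident to at most $\lceil d(v)/2\rceil$ edges of each color. $\chi'_{qm\Sigma}(G)$ is the minimum $k$ such that $G$ has a QM and NSD $k$-edge-coloring. -}

module Defs where

open import Data.Nat using (ℕ; zero; suc; _+_; _≤_; _≡ᵇ_; ⌈_/2⌉)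
open import Data.Fin using (Fin; toℕ)
open import Data.Bool using (if_then_else_)
open import Data.Product using (_×_; Σ)
open import Relation.Binary.PropositionalEquality using (_≡_; _≢_)

Σ[<] : (n : ℕ) → (Fin n → ℕ) → ℕ
Σ[<] zero    f = 0
Σ[<] (suc n) f = f Fin.zero + Σ[<] n (λ i → f (Fin.suc i))

count : (n : ℕ) → (Fin n → ℕ) → ℕ → ℕ
count n f a = Σ[<] n (λ i → if f i ≡ᵇ a then 1 else 0)

-- An edge coloring of K_{n,m}: left part Fin n, right part Fin m,
-- the edge (i , j) gets color  c i j + 1  ∈ [k]  where  c i j : Fin k.
EdgeColoring : ℕ → ℕ → ℕ → Set
EdgeColoring n m k = Fin n → Fin m → Fin k

col : ∀ {n m k} → EdgeColoring n m k → Fin n → Fin m → ℕ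
col c i j = suc (toℕ (c i j))

σL : ∀ {n m k} → EdgeColoring n m k → Fin n → ℕ
σL {m = m} c i = Σ[<] m (λ j → col c i j)

σR : ∀ {n m k} → EdgeColoring n m k → Fin m → ℕ
σR {n = n} c j = Σ[<] n (λ i → col c i j)

NSD : ∀ {n m k} → EdgeColoring n m k → Set
NSD c = ∀ i j → σL c i ≢ σR c j

QM : ∀ {n m k} → EdgeColoring n m k → Set
QM {n} {m} c =
  (∀ i (a : ℕ) → count m (λ j → col c i j) a ≤ ⌈ m /2⌉) ×
  (∀ j (a : ℕ) → count n (λ i → col c i j) a ≤ ⌈ n /2⌉)

HasQMNSD : ℕ → ℕ → ℕ → Set
HasQMNSD n m k = Σ (EdgeColoring n m k) (λ c → QM c × NSD c)

ChiQMΣ≡ : ℕ → ℕ → ℕ → Set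
ChiQMΣ≡ n m k = HasQMNSD n m k × (∀ k' → HasQMNSD n m k' → k ≤ k')

-- A checkerboard 2-colouring of K_{n,m} has row sums m + ⌊m/2⌋ or m + ⌈m/2⌉ and column sums
-- n + ⌊n/2⌋ or n + ⌈n/2⌉, and these ranges are disjoint as soon as n ≠ m. One colour never
-- suffices, since a vertex of degree d ≥ 2 would carry d > ⌈d/2⌉ edges of that colour.
-- For n = m = d, quasi-majority forces every vertex sum of a 2-colouring into {t - 1, t} with
-- t = d + ⌈d/2⌉; an NSD colouring then gives all rows one of these values and all columns the
-- other, contradicting that rows and columns both add up to the total colour weight.
-- Three colours suffice for d ≥ 4: two rows use colours 1, 2 and the others colours 2, 3, each
-- in the checkerboard pattern, which separates light rows, columns and heavy rows by their sums;
-- K_{3,3} is coloured by hand.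
module Submission where

open import Defs
open import Data.Bool using (Bool; true; false; _xor_; if_then_else_; T)
open import Data.Empty using (⊥-elim)
open import Data.Fin using (Fin; toℕ; zero; suc; inject₁)
open import Data.Fin.Patterns using (0F; 1F; 2F)
open import Data.Nat using (ℕ; zero; suc; _+_; _*_; _≤_; _<_; _≡ᵇ_; ⌊_/2⌋; ⌈_/2⌉; z≤n; s≤s)
open import Data.Nat.Properties
open import Data.Nat.Tactic.RingSolver using (solve-∀)
open import Algebra.Properties.CommutativeMonoid.Sum +-0-commutativeMonoid using (sum; ∑-comm; sum-cong-≗)
open import Data.Product using (_×_; _,_; proj₁; proj₂)
open import Data.Sum using (_⊎_; inj₁; inj₂)
open import Data.Unit using (⊤; tt)
open import Relation.Binary using (Tri; tri<; tri≈; tri>)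
open import Relation.Binary.PropositionalEquality
open import Relation.Nullary using (¬_)

Σ[<]≡sum : ∀ n (f : Fin n → ℕ) → Σ[<] n f ≡ sum f
Σ[<]≡sum zero    f = refl
Σ[<]≡sum (suc n) f = cong (f zero +_) (Σ[<]≡sum n (λ i → f (suc i)))

Σ[<]-comm : ∀ n m (f : Fin n → Fin m → ℕ) →
            Σ[<] n (λ i → Σ[<] m (f i)) ≡ Σ[<] m (λ j → Σ[<] n (λ i → f i j))
Σ[<]-comm n m f = begin
  Σ[<] n (λ i → Σ[<] m (f i))          ≡⟨ Σ[<]≡sum n _ ⟩
  sum (λ i → Σ[<] m (f i))             ≡⟨ sum-cong-≗ (λ i → Σ[<]≡sum m (f i)) ⟩
  sum (λ i → sum (f i))                ≡⟨ ∑-comm f ⟩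
  sum (λ j → sum (λ i → f i j))        ≡⟨ sum-cong-≗ (λ j → Σ[<]≡sum n (λ i → f i j)) ⟨
  sum (λ j → Σ[<] n (λ i → f i j))     ≡⟨ Σ[<]≡sum m _ ⟨
  Σ[<] m (λ j → Σ[<] n (λ i → f i j)) ∎
  where open ≡-Reasoning

Σ[<]-const : ∀ n {f : Fin n → ℕ} {a} → (∀ i → f i ≡ a) → Σ[<] n f ≡ n * a
Σ[<]-const zero    f≡a = refl
Σ[<]-const (suc n) f≡a = cong₂ _+_ (f≡a zero) (Σ[<]-const n (λ i → f≡a (suc i)))

⌈n/2⌉≤1+⌊n/2⌋ : ∀ n → ⌈ n /2⌉ ≤ suc ⌊ n /2⌋
⌈n/2⌉≤1+⌊n/2⌋ zero          = z≤n
⌈n/2⌉≤1+⌊n/2⌋ (suc zero)    = ≤-refl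
⌈n/2⌉≤1+⌊n/2⌋ (suc (suc n)) = s≤s (⌈n/2⌉≤1+⌊n/2⌋ n)

⌈n/2⌉+⌈n/2⌉≤1+n : ∀ n → ⌈ n /2⌉ + ⌈ n /2⌉ ≤ suc n
⌈n/2⌉+⌈n/2⌉≤1+n n = begin
  ⌈ n /2⌉ + ⌈ n /2⌉      ≤⟨ +-monoˡ-≤ ⌈ n /2⌉ (⌈n/2⌉≤1+⌊n/2⌋ n) ⟩
  suc ⌊ n /2⌋ + ⌈ n /2⌉  ≡⟨ cong suc (⌊n/2⌋+⌈n/2⌉≡n n) ⟩
  suc n                   ∎
  where open ≤-Reasoning

n≤⌈n/2⌉⇒n≤1 : ∀ {n} → n ≤ ⌈ n /2⌉ → n ≤ 1
n≤⌈n/2⌉⇒n≤1 {zero}        _ = z≤n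
n≤⌈n/2⌉⇒n≤1 {suc zero}    _ = ≤-refl
n≤⌈n/2⌉⇒n≤1 {suc (suc n)} n≤⌈n/2⌉ = ⊥-elim (<⇒≱ (⌈n/2⌉<n n) n≤⌈n/2⌉)

-- Alternating sequences

-- Two steps at a time, so that parity (suc (suc i)) reduces to parity i and an alternating
-- sum unfolds definitionally by one period.
parity : ∀ {n} → Fin n → Bool
parity zero          = false
parity (suc zero)    = true
parity (suc (suc i)) = parity i

Σ[<]-alternating : ∀ m (F : Bool → ℕ) →
                   Σ[<] m (λ j → F (parity j)) ≡ ⌊ m /2⌋ * F true + ⌈ m /2⌉ * F false
Σ[<]-alternating zero          F = refl
Σ[<]-alternating (suc zero)    F = refl
Σ[<]-alternating (suc (suc m)) F = begin
  F false + (F true + Σ[<] m (λ j → F (parity j)))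
    ≡⟨ cong (λ s → F false + (F true + s)) (Σ[<]-alternating m F) ⟩
  F false + (F true + (⌊ m /2⌋ * F true + ⌈ m /2⌉ * F false))
    ≡⟨ regroup (F false) (F true) ⌊ m /2⌋ ⌈ m /2⌉ ⟩
  suc ⌊ m /2⌋ * F true + suc ⌈ m /2⌉ * F false ∎
  where
  open ≡-Reasoning
  regroup : ∀ a b x y → a + (b + (x * b + y * a)) ≡ suc x * b + suc y * a
  regroup = solve-∀

data Consecutive (lo : ℕ) (F : Bool → ℕ) : Set where
  ascending  : F false ≡ lo → F true ≡ suc lo → Consecutive lo F
  descending : F false ≡ suc lo → F true ≡ lo → Consecutive lo F

consecutive-suc : ∀ {lo F} → Consecutive lo F → Consecutive (suc lo) (λ x → suc (F x))
consecutive-suc (ascending  f≡ t≡) = ascending  (cong suc f≡) (cong suc t≡)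
consecutive-suc (descending f≡ t≡) = descending (cong suc f≡) (cong suc t≡)

consecutive-distinct : ∀ {lo F} → Consecutive lo F → F false ≢ F true
consecutive-distinct {lo} (ascending  f≡ t≡) f≡t = <⇒≢ (n<1+n lo) (trans (sym f≡) (trans f≡t t≡))
consecutive-distinct {lo} (descending f≡ t≡) f≡t = <⇒≢ (n<1+n lo) (trans (sym t≡) (trans (sym f≡t) f≡))

Σ[<]-alternating-bounds : ∀ m {lo F} → Consecutive lo F →
  m * lo + ⌊ m /2⌋ ≤ Σ[<] m (λ j → F (parity j)) × Σ[<] m (λ j → F (parity j)) ≤ m * lo + ⌈ m /2⌉
Σ[<]-alternating-bounds m {lo} {F} (ascending f≡ t≡) =
  ≤-reflexive (sym sum≡) , ≤-trans (≤-reflexive sum≡) (+-monoʳ-≤ (m * lo) (⌊n/2⌋≤⌈n/2⌉ m))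
  where
  open ≡-Reasoning
  regroup : ∀ x y l → x * suc l + y * l ≡ (x + y) * l + x
  regroup = solve-∀
  sum≡ : Σ[<] m (λ j → F (parity j)) ≡ m * lo + ⌊ m /2⌋
  sum≡ = begin
    Σ[<] m (λ j → F (parity j))           ≡⟨ Σ[<]-alternating m F ⟩
    ⌊ m /2⌋ * F true + ⌈ m /2⌉ * F false  ≡⟨ cong₂ (λ t f → ⌊ m /2⌋ * t + ⌈ m /2⌉ * f) t≡ f≡ ⟩
    ⌊ m /2⌋ * suc lo + ⌈ m /2⌉ * lo       ≡⟨ regroup ⌊ m /2⌋ ⌈ m /2⌉ lo ⟩
    (⌊ m /2⌋ + ⌈ m /2⌉) * lo + ⌊ m /2⌋    ≡⟨ cong (λ k → k * lo + ⌊ m /2⌋) (⌊n/2⌋+⌈n/2⌉≡n m) ⟩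
    m * lo + ⌊ m /2⌋                      ∎
Σ[<]-alternating-bounds m {lo} {F} (descending f≡ t≡) =
  ≤-trans (+-monoʳ-≤ (m * lo) (⌊n/2⌋≤⌈n/2⌉ m)) (≤-reflexive (sym sum≡)) , ≤-reflexive sum≡
  where
  open ≡-Reasoning
  regroup : ∀ x y l → x * l + y * suc l ≡ (x + y) * l + y
  regroup = solve-∀
  sum≡ : Σ[<] m (λ j → F (parity j)) ≡ m * lo + ⌈ m /2⌉
  sum≡ = begin
    Σ[<] m (λ j → F (parity j))           ≡⟨ Σ[<]-alternating m F ⟩
    ⌊ m /2⌋ * F true + ⌈ m /2⌉ * F false  ≡⟨ cong₂ (λ t f → ⌊ m /2⌋ * t + ⌈ m /2⌉ * f) t≡ f≡ ⟩
    ⌊ m /2⌋ * lo + ⌈ m /2⌉ * suc lo       ≡⟨ regroup ⌊ m /2⌋ ⌈ m /2⌉ lo ⟩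
    (⌊ m /2⌋ + ⌈ m /2⌉) * lo + ⌈ m /2⌉    ≡⟨ cong (λ k → k * lo + ⌈ m /2⌉) (⌊n/2⌋+⌈n/2⌉≡n m) ⟩
    m * lo + ⌈ m /2⌉                      ∎

-- Counting colours

PairsDistinct : ∀ n → (Fin n → ℕ) → Set
PairsDistinct zero          f = ⊤
PairsDistinct (suc zero)    f = ⊤
PairsDistinct (suc (suc n)) f = f zero ≢ f (suc zero) × PairsDistinct n (λ i → f (suc (suc i)))

indicator : ℕ → ℕ → ℕ
indicator a x = if x ≡ᵇ a then 1 else 0

indicator≤1 : ∀ a x → indicator a x ≤ 1
indicator≤1 a x with x ≡ᵇ a
... | true  = ≤-refl
... | false = z≤n

indicators-distinct : ∀ a {x y} → x ≢ y → indicator a x + indicator a y ≤ 1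
indicators-distinct a {x} {y} x≢y with x ≡ᵇ a in x≡ᵇa | y ≡ᵇ a in y≡ᵇa
... | true  | true  = ⊥-elim (x≢y (trans (≡ᵇ-true x≡ᵇa) (sym (≡ᵇ-true y≡ᵇa))))
  where
  ≡ᵇ-true : ∀ {u} → (u ≡ᵇ a) ≡ true → u ≡ a
  ≡ᵇ-true {u} eq = ≡ᵇ⇒≡ u a (subst T (sym eq) tt)
... | true  | false = ≤-refl
... | false | true  = ≤-refl
... | false | false = z≤n

count-pairsDistinct : ∀ n (f : Fin n → ℕ) a → PairsDistinct n f → count n f a ≤ ⌈ n /2⌉
count-pairsDistinct zero          f a _ = z≤n
count-pairsDistinct (suc zero)    f a _ = +-monoˡ-≤ 0 (indicator≤1 a (f zero))
count-pairsDistinct (suc (suc n)) f a (f₀≢f₁ , rest) = begin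
  u + (v + count n f₂ a)  ≡⟨ +-assoc u v (count n f₂ a) ⟨
  u + v + count n f₂ a    ≤⟨ +-mono-≤ (indicators-distinct a f₀≢f₁) (count-pairsDistinct n f₂ a rest) ⟩
  suc ⌈ n /2⌉             ∎
  where
  open ≤-Reasoning
  u = indicator a (f 0F)
  v = indicator a (f 1F)
  f₂ : Fin n → ℕ
  f₂ i = f (suc (suc i))

alternating-pairsDistinct : ∀ m {lo F} → Consecutive lo F → PairsDistinct m (λ j → F (parity j))
alternating-pairsDistinct zero          _      = tt
alternating-pairsDistinct (suc zero)    _      = tt
alternating-pairsDistinct (suc (suc m)) F-cons = consecutive-distinct F-cons , alternating-pairsDistinct m F-cons

count-alternating : ∀ m {lo F} a → Consecutive lo F → count m (λ j → F (parity j)) a ≤ ⌈ m /2⌉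
count-alternating m a F-cons = count-pairsDistinct m _ a (alternating-pairsDistinct m F-cons)

count-one-colour : ∀ m (f : Fin m → Fin 1) → count m (λ j → suc (toℕ (f j))) 1 ≡ m
count-one-colour zero    f = refl
count-one-colour (suc m) f with f zero
... | zero = cong suc (count-one-colour m (λ j → f (suc j)))

Σ[<]-two-colours : ∀ d (f : Fin d → Fin 2) →
  Σ[<] d (λ j → suc (toℕ (f j))) ≡ d + count d (λ j → suc (toℕ (f j))) 2
Σ[<]-two-colours zero    f = refl
Σ[<]-two-colours (suc d) f with f zero | Σ[<]-two-colours d (λ j → f (suc j))
... | 0F | ih = cong suc ih
... | 1F | ih = cong suc (trans (cong suc ih) (sym (+-suc d _)))

count-two-colours : ∀ d (f : Fin d → Fin 2) →
  count d (λ j → suc (toℕ (f j))) 1 + count d (λ j → suc (toℕ (f j))) 2 ≡ d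
count-two-colours zero    f = refl
count-two-colours (suc d) f with f zero | count-two-colours d (λ j → f (suc j))
... | 0F | ih = cong suc ih
... | 1F | ih = trans (+-suc _ _) (cong suc ih)

-- Lower bounds

2≤colours : ∀ {n m k} → ¬ (suc n ≡ 1 × suc m ≡ 1) → HasQMNSD (suc n) (suc m) k → 2 ≤ k
2≤colours {k = zero} _ (c , _) with c zero zero
... | ()
2≤colours {n} {m} {suc zero} not-K₁₁ (c , (rowQM , columnQM) , _) =
  ⊥-elim (not-K₁₁ (≤-antisym n≤1 (s≤s z≤n) , ≤-antisym m≤1 (s≤s z≤n)))
  where
  m≤1 : suc m ≤ 1
  m≤1 = n≤⌈n/2⌉⇒n≤1 (subst (_≤ ⌈ suc m /2⌉) (count-one-colour (suc m) (c zero)) (rowQM zero 1))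
  n≤1 : suc n ≤ 1
  n≤1 = n≤⌈n/2⌉⇒n≤1 (subst (_≤ ⌈ suc n /2⌉) (count-one-colour (suc n) (λ i → c i zero)) (columnQM zero 1))
2≤colours {k = suc (suc k)} _ _ = s≤s (s≤s z≤n)

AtMostOneBelow : ℕ → ℕ → Set
AtMostOneBelow v t = v ≤ t × t ≤ suc v

atMostOneBelow⇒≡⊎1+≡ : ∀ {v t} → AtMostOneBelow v t → v ≡ t ⊎ suc v ≡ t
atMostOneBelow⇒≡⊎1+≡ (v≤t , t≤1+v) with m≤n⇒m<n∨m≡n v≤t
... | inj₁ v<t = inj₂ (≤-antisym v<t t≤1+v)
... | inj₂ v≡t = inj₁ v≡t

atMostOneBelow-pigeonhole : ∀ {t x y z} →
  AtMostOneBelow x t → AtMostOneBelow y t → AtMostOneBelow z t → x ≢ z → y ≢ z → x ≡ y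
atMostOneBelow-pigeonhole x≈t y≈t z≈t x≢z y≢z
  with atMostOneBelow⇒≡⊎1+≡ x≈t | atMostOneBelow⇒≡⊎1+≡ y≈t | atMostOneBelow⇒≡⊎1+≡ z≈t
... | inj₁ x≡t | inj₁ y≡t | _        = trans x≡t (sym y≡t)
... | inj₂ x≡t | inj₂ y≡t | _        = suc-injective (trans x≡t (sym y≡t))
... | inj₁ x≡t | inj₂ y≡t | inj₁ z≡t = ⊥-elim (x≢z (trans x≡t (sym z≡t)))
... | inj₁ x≡t | inj₂ y≡t | inj₂ z≡t = ⊥-elim (y≢z (suc-injective (trans y≡t (sym z≡t))))
... | inj₂ x≡t | inj₁ y≡t | inj₁ z≡t = ⊥-elim (y≢z (trans y≡t (sym z≡t)))
... | inj₂ x≡t | inj₁ y≡t | inj₂ z≡t = ⊥-elim (x≢z (suc-injective (trans x≡t (sym z≡t))))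

two-colour-sum-window : ∀ d (f : Fin d → Fin 2) →
  (∀ a → count d (λ j → suc (toℕ (f j))) a ≤ ⌈ d /2⌉) →
  AtMostOneBelow (Σ[<] d (λ j → suc (toℕ (f j)))) (d + ⌈ d /2⌉)
two-colour-sum-window d f qm = upper , +-cancelʳ-≤ h (d + h) (suc v) lower
  where
  g = λ j → suc (toℕ (f j))
  h = ⌈ d /2⌉
  v = Σ[<] d g
  c₁ = count d g 1
  c₂ = count d g 2
  upper : v ≤ d + h
  upper = ≤-trans (≤-reflexive (Σ[<]-two-colours d f)) (+-monoʳ-≤ d (qm 2))
  v+c₁≡d+d : v + c₁ ≡ d + d
  v+c₁≡d+d = begin
    v + c₁         ≡⟨ cong (_+ c₁) (Σ[<]-two-colours d f) ⟩
    d + c₂ + c₁    ≡⟨ +-assoc d c₂ c₁ ⟩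
    d + (c₂ + c₁)  ≡⟨ cong (d +_) (trans (+-comm c₂ c₁) (count-two-colours d f)) ⟩
    d + d          ∎
    where open ≡-Reasoning
  lower : d + h + h ≤ suc v + h
  lower = begin
    d + h + h      ≡⟨ +-assoc d h h ⟩
    d + (h + h)    ≤⟨ +-monoʳ-≤ d (⌈n/2⌉+⌈n/2⌉≤1+n d) ⟩
    d + suc d      ≡⟨ +-suc d d ⟩
    suc (d + d)    ≡⟨ cong suc v+c₁≡d+d ⟨
    suc (v + c₁)   ≤⟨ s≤s (+-monoʳ-≤ v (qm 1)) ⟩
    suc v + h      ∎
    where open ≤-Reasoning

square-not-2-colourable : ∀ d → ¬ HasQMNSD (suc d) (suc d) 2
square-not-2-colourable d (c , (rowQM , columnQM) , nsd) = nsd 0F 0F (*-cancelˡ-≡ _ _ (suc d) total)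
  where
  row≈ : ∀ i → AtMostOneBelow (σL c i) (suc d + ⌈ suc d /2⌉)
  row≈ i = two-colour-sum-window (suc d) (c i) (rowQM i)
  column≈ : ∀ j → AtMostOneBelow (σR c j) (suc d + ⌈ suc d /2⌉)
  column≈ j = two-colour-sum-window (suc d) (λ i → c i j) (columnQM j)
  rows≡ : ∀ i → σL c i ≡ σL c 0F
  rows≡ i = atMostOneBelow-pigeonhole (row≈ i) (row≈ 0F) (column≈ 0F) (nsd i 0F) (nsd 0F 0F)
  columns≡ : ∀ j → σR c j ≡ σR c 0F
  columns≡ j = atMostOneBelow-pigeonhole (column≈ j) (column≈ 0F) (row≈ 0F)
                 (λ eq → nsd 0F j (sym eq)) (λ eq → nsd 0F 0F (sym eq))
  total : suc d * σL c 0F ≡ suc d * σR c 0F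
  total = trans (sym (Σ[<]-const (suc d) rows≡))
                (trans (Σ[<]-comm (suc d) (suc d) (col c)) (Σ[<]-const (suc d) columns≡))

3≤colours-square : ∀ {d k} → ¬ (suc d ≡ 1 × suc d ≡ 1) → HasQMNSD (suc d) (suc d) k → 3 ≤ k
3≤colours-square {d} not-K₁₁ colouring =
  ≤∧≢⇒< (2≤colours not-K₁₁ colouring) λ { refl → square-not-2-colourable d colouring }

-- Colourings

checker : Bool → Bool → Fin 2
checker a b = if a xor b then 1F else 0F

checker-row : ∀ a → Consecutive 1 (λ x → suc (toℕ (checker a x)))
checker-row false = ascending refl refl
checker-row true  = descending refl refl

checker-column : ∀ b → Consecutive 1 (λ x → suc (toℕ (checker x b)))
checker-column false = ascending refl refl
checker-column true  = descending refl refl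

checkerboard : ∀ {n m} → EdgeColoring n m 2
checkerboard i j = checker (parity i) (parity j)

checkerboard-QM : ∀ {n m} → QM (checkerboard {n} {m})
checkerboard-QM {n} {m} =
  (λ i a → count-alternating m a (checker-row (parity i))) ,
  (λ j a → count-alternating n a (checker-column (parity j)))

alternating-sums-separated : ∀ {n m x y} → n < m →
  x ≤ n * 1 + ⌈ n /2⌉ → m * 1 + ⌊ m /2⌋ ≤ y → x < y
alternating-sums-separated {n} {m} {x} {y} n<m x≤ ≤y = begin-strict
  x                  ≤⟨ x≤ ⟩
  n * 1 + ⌈ n /2⌉    ≡⟨ cong (_+ ⌈ n /2⌉) (*-identityʳ n) ⟩
  n + ⌊ suc n /2⌋    <⟨ +-mono-<-≤ n<m (⌊n/2⌋-mono n<m) ⟩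
  m + ⌊ m /2⌋        ≡⟨ cong (_+ ⌊ m /2⌋) (*-identityʳ m) ⟨
  m * 1 + ⌊ m /2⌋    ≤⟨ ≤y ⟩
  y                  ∎
  where open ≤-Reasoning

checkerboard-NSD : ∀ {n m} → n ≢ m → NSD (checkerboard {n} {m})
checkerboard-NSD {n} {m} n≢m i j = separate (<-cmp n m)
  where
  row = Σ[<]-alternating-bounds m (checker-row (parity i))
  column = Σ[<]-alternating-bounds n (checker-column (parity j))
  separate : Tri (n < m) (n ≡ m) (m < n) → σL (checkerboard {n} {m}) i ≢ σR (checkerboard {n} {m}) j
  separate (tri< n<m _ _) eq = <⇒≢ (alternating-sums-separated n<m (proj₂ column) (proj₁ row)) (sym eq)
  separate (tri≈ _ n≡m _) _  = n≢m n≡m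
  separate (tri> _ _ m<n) eq = <⇒≢ (alternating-sums-separated m<n (proj₂ row) (proj₁ column)) eq

light-row : ∀ a → Consecutive 1 (λ x → suc (toℕ (inject₁ (checker a x))))
light-row false = ascending refl refl
light-row true  = descending refl refl

light-pair : ∀ b → let u = suc (toℕ (inject₁ (checker false b)))
                       v = suc (toℕ (inject₁ (checker true b)))
                   in u ≢ v × u + v ≡ 3
light-pair false = (λ ()) , refl
light-pair true  = (λ ()) , refl

threeColouring : ∀ {n} → EdgeColoring n n 3
threeColouring 0F            j = inject₁ (checker false (parity j))
threeColouring 1F            j = inject₁ (checker true (parity j))
threeColouring (suc (suc i)) j = suc (checker (parity i) (parity j))

module _ (e : ℕ) where

  threeColouring-QM : QM (threeColouring {2 + e})
  threeColouring-QM = rows , columns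
    where
    rows : ∀ i a → count (2 + e) (λ j → col threeColouring i j) a ≤ ⌈ 2 + e /2⌉
    rows 0F            a = count-alternating (2 + e) a (light-row false)
    rows 1F            a = count-alternating (2 + e) a (light-row true)
    rows (suc (suc i)) a = count-alternating (2 + e) a (consecutive-suc (checker-row (parity i)))
    columns : ∀ j a → count (2 + e) (λ i → col threeColouring i j) a ≤ ⌈ 2 + e /2⌉
    columns j a = count-pairsDistinct (2 + e) (λ i → col threeColouring i j) a
      (proj₁ (light-pair (parity j)) ,
       alternating-pairsDistinct e (consecutive-suc (checker-column (parity j))))

  threeColouring-σR : ∀ j →
    3 + (e * 2 + ⌊ e /2⌋) ≤ σR (threeColouring {2 + e}) j ×
    σR (threeColouring {2 + e}) j ≤ 3 + (e * 2 + ⌈ e /2⌉)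
  threeColouring-σR j =
    ≤-trans (+-monoʳ-≤ 3 (proj₁ bounds)) (≤-reflexive (sym σR≡)) ,
    ≤-trans (≤-reflexive σR≡) (+-monoʳ-≤ 3 (proj₂ bounds))
    where
    b = parity j
    u = suc (toℕ (inject₁ (checker false b)))
    v = suc (toℕ (inject₁ (checker true b)))
    tail = Σ[<] e (λ i → suc (suc (toℕ (checker (parity i) b))))
    σR≡ : σR (threeColouring {2 + e}) j ≡ 3 + tail
    σR≡ = trans (sym (+-assoc u v tail)) (cong (_+ tail) (proj₂ (light-pair b)))
    bounds = Σ[<]-alternating-bounds e (consecutive-suc (checker-column b))

light-row-below-column : ∀ f {x y} →
  x ≤ (4 + f) * 1 + ⌈ 4 + f /2⌉ → 3 + ((2 + f) * 2 + ⌊ 2 + f /2⌋) ≤ y → x < y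
light-row-below-column f {x} {y} x≤ ≤y = begin-strict
  x                                      ≤⟨ x≤ ⟩
  (4 + f) * 1 + ⌈ 4 + f /2⌉              ≤⟨ +-monoʳ-≤ ((4 + f) * 1) (s≤s (s≤s (⌈n/2⌉≤1+⌊n/2⌋ f))) ⟩
  (4 + f) * 1 + (3 + ⌊ f /2⌋)            <⟨ n<1+n _ ⟩
  suc ((4 + f) * 1 + (3 + ⌊ f /2⌋))      ≤⟨ m≤n+m _ f ⟩
  f + suc ((4 + f) * 1 + (3 + ⌊ f /2⌋))  ≡⟨ regroup f ⌊ f /2⌋ ⟩
  3 + ((2 + f) * 2 + ⌊ 2 + f /2⌋)        ≤⟨ ≤y ⟩
  y                                      ∎
  where
  open ≤-Reasoning
  regroup : ∀ f x → f + suc ((4 + f) * 1 + (3 + x)) ≡ 3 + ((2 + f) * 2 + (1 + x))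
  regroup = solve-∀

column-below-heavy-row : ∀ f {x y} →
  x ≤ 3 + ((2 + f) * 2 + ⌈ 2 + f /2⌉) → (4 + f) * 2 + ⌊ 4 + f /2⌋ ≤ y → x < y
column-below-heavy-row f {x} {y} x≤ ≤y = begin-strict
  x                                        ≤⟨ x≤ ⟩
  3 + ((2 + f) * 2 + ⌈ 2 + f /2⌉)          ≤⟨ +-monoʳ-≤ (3 + (2 + f) * 2) (s≤s (⌈n/2⌉≤1+⌊n/2⌋ f)) ⟩
  3 + ((2 + f) * 2 + (2 + ⌊ f /2⌋))        <⟨ n<1+n _ ⟩
  suc (3 + ((2 + f) * 2 + (2 + ⌊ f /2⌋)))  ≡⟨ regroup f ⌊ f /2⌋ ⟩
  (4 + f) * 2 + ⌊ 4 + f /2⌋                ≤⟨ ≤y ⟩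
  y                                        ∎
  where
  open ≤-Reasoning
  regroup : ∀ f x → suc (3 + ((2 + f) * 2 + (2 + x))) ≡ (4 + f) * 2 + (2 + x)
  regroup = solve-∀

threeColouring-NSD : ∀ f → NSD (threeColouring {4 + f})
threeColouring-NSD f 0F j eq =
  <⇒≢ (light-row-below-column f (proj₂ (Σ[<]-alternating-bounds (4 + f) (light-row false)))
                                 (proj₁ (threeColouring-σR (2 + f) j))) eq
threeColouring-NSD f 1F j eq =
  <⇒≢ (light-row-below-column f (proj₂ (Σ[<]-alternating-bounds (4 + f) (light-row true)))
                                 (proj₁ (threeColouring-σR (2 + f) j))) eq
threeColouring-NSD f (suc (suc i)) j eq =
  <⇒≢ (column-below-heavy-row f (proj₂ (threeColouring-σR (2 + f) j))
         (proj₁ (Σ[<]-alternating-bounds (4 + f) (consecutive-suc (checker-row (parity i)))))) (sym eq)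

k33 : EdgeColoring 3 3 3
k33 0F j = inject₁ (checker false (parity j))
k33 _  j = suc (checker false (parity j))

k33-QM : QM k33
k33-QM = rows , columns
  where
  rows : ∀ i a → count 3 (λ j → col k33 i j) a ≤ 2
  rows 0F      a = count-alternating 3 a (light-row false)
  rows (suc _) a = count-alternating 3 a (consecutive-suc (checker-row false))
  columns : ∀ j a → count 3 (λ i → col k33 i j) a ≤ 2
  columns 0F a = count-pairsDistinct 3 (λ i → col k33 i 0F) a ((λ ()) , tt)
  columns 1F a = count-pairsDistinct 3 (λ i → col k33 i 1F) a ((λ ()) , tt)
  columns 2F a = count-pairsDistinct 3 (λ i → col k33 i 2F) a ((λ ()) , tt)

k33-NSD : NSD k33
k33-NSD 0F      0F ()
k33-NSD 0F      1F ()
k33-NSD 0F      2F ()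
k33-NSD (suc _) 0F ()
k33-NSD (suc _) 1F ()
k33-NSD (suc _) 2F ()

square-3-colourable : ∀ n → ¬ (suc n ≡ 1 × suc n ≡ 1) → ¬ (suc n ≡ 2 × suc n ≡ 2) →
                      HasQMNSD (suc n) (suc n) 3
square-3-colourable 0             not-K₁₁ _       = ⊥-elim (not-K₁₁ (refl , refl))
square-3-colourable 1             _       not-K₂₂ = ⊥-elim (not-K₂₂ (refl , refl))
square-3-colourable 2             _       _       = k33 , k33-QM , k33-NSD
square-3-colourable (suc (suc (suc f))) _ _ =
  threeColouring , threeColouring-QM (2 + f) , threeColouring-NSD f

mainTheorem5 : (n m : ℕ) → 1 ≤ n → 1 ≤ m →
    ¬ (n ≡ 1 × m ≡ 1) → ¬ (n ≡ 2 × m ≡ 2) →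
    (n ≢ m → ChiQMΣ≡ n m 2) × (n ≡ m → ChiQMΣ≡ n m 3)
mainTheorem5 (suc n) (suc m) _ _ not-K₁₁ not-K₂₂ = unbalanced , balanced
  where
  unbalanced : suc n ≢ suc m → ChiQMΣ≡ (suc n) (suc m) 2
  unbalanced n≢m = (checkerboard , checkerboard-QM , checkerboard-NSD n≢m) , λ _ → 2≤colours not-K₁₁
  balanced : suc n ≡ suc m → ChiQMΣ≡ (suc n) (suc m) 3
  balanced refl = square-3-colourable n not-K₁₁ not-K₂₂ , λ _ → 3≤colours-square not-K₁₁
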